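{- For any integer $k\geq 1$, there are infinitely many integers $n\geq 1$ such that every cycle of the permutation $\psi_n$ of $\{1,\dots,2n\}$ defined by $\psi_n(2i)=i$ and $\psi_n(2i-1)=n+i$ for $1\leq i\leq n$ has length strictly greater than $k$; equivalently, every string in the multiset $W(n)$ has length strictly greater than $k$.
   Context: Over the binary alphabet $\{a,b\}$ with $a<b$, consider $L=(ba)^n$ (position $j$ of $L$ is $b$ if $j$ odd and $a$ if $j$ even) and $F=a^nb^n$ (the letters of $L$ sorted). The standard eBWT inversion matches the $i$-th occurrence of $a$ in $L$ (position $2i$) with the $i$-th occurrence of $a$ in $F$ (position $i$), and the $i$-th occurrence of $b$ in $L$ (position $2i-1$) with the $i$-th occurrence of $b$ in $F$ (position $n+i$); this gives the permutation $\psi_n$. $W(n)$ denotes the multiset of strings with extended Burrows–Wheeler transform $(ba)^n$ obtained by this inversion: its strings correspond (up to rotation) to the cycles of $\psi_n$, each string having length equal to the length of its cycle. -}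

module Defs where

open import Data.Nat using (ℕ; zero; suc; _+_; _*_; _≤_; _<_; ⌊_/2⌋; ⌈_/2⌉)
open import Data.Bool using (Bool; true; false; if_then_else_)
open import Data.Product using (Σ; _×_)
open import Relation.Binary.PropositionalEquality using (_≡_; _≢_)

isEven : ℕ → Bool
isEven zero = true
isEven (suc zero) = false
isEven (suc (suc j)) = isEven j

-- ψ_n on positions {1,…,2n} (1-indexed, as in the paper):
--   ψ_n(2i) = i,  ψ_n(2i-1) = n + i.
ψ : ℕ → ℕ → ℕ
ψ n j = if isEven j then ⌊ j /2⌋ else n + ⌈ j /2⌉

iter : (ℕ → ℕ) → ℕ → ℕ → ℕ
iter f zero    x = x
iter f (suc m) x = f (iter f m x)

CycleLength : (ℕ → ℕ) → ℕ → ℕ → Set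
CycleLength f x ℓ =
  (1 ≤ ℓ) × (iter f ℓ x ≡ x) × (∀ m → 1 ≤ m → m < ℓ → iter f m x ≢ x)

AllCyclesLongerThan : ℕ → ℕ → Set
AllCyclesLongerThan k n =
  ∀ x → 1 ≤ x → x ≤ 2 * n → Σ ℕ (λ ℓ → CycleLength (ψ n) x ℓ × k < ℓ)

{-# OPTIONS --safe #-}
-- Doubling modulo m = 2n + 1 undoes ψ_n: 2 ψ_n(j) ≡ j (mod m), hence 2^a ψ_n^a(j) ≡ j.
-- If 2n = 2^t then 2^t ≡ -1, so ψ_n^t(j) = m - j: ψ_n^(2t) fixes every point while, m being
-- odd, ψ_n^t fixes none. For t = 2^s every cycle length therefore divides 2^(s+1) but not 2^s,
-- i.e. all cycles have length exactly 2^(s+1), and s can be taken as large as we like.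
module Submission where

open import Defs
open import Data.Nat
open import Data.Nat.Properties
open import Data.Nat.Divisibility
open import Data.Nat.GCD using (gcd; gcd-GCD; gcd[m,n]∣m; gcd[m,n]∣n; module Bézout)
open import Data.Nat.Primality using (Prime; prime[2]; prime⇒nonZero; euclidsLemma)
open import Data.Nat.Solver using (module +-*-Solver)
open import Data.Product using (Σ; ∃; _×_; _,_; proj₂)
open import Data.Bool using (true; false)
open import Data.Sum using (inj₁; inj₂)
open import Relation.Binary.PropositionalEquality
open import Relation.Nullary using (¬_; contradiction)

open +-*-Solver
open ≡-Reasoning

iter-+ : ∀ (f : ℕ → ℕ) a b x → iter f (a + b) x ≡ iter f a (iter f b x)
iter-+ f zero    b x = refl
iter-+ f (suc a) b x = cong f (iter-+ f a b x)

iter-preserves : ∀ {f : ℕ → ℕ} (P : ℕ → Set) → (∀ {y} → P y → P (f y)) →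
                 ∀ a {x} → P x → P (iter f a x)
iter-preserves P step zero    px = px
iter-preserves P step (suc a) px = step (iter-preserves P step a px)

Period : (ℕ → ℕ) → ℕ → ℕ → Set
Period f x a = iter f a x ≡ x

module _ {f : ℕ → ℕ} {x : ℕ} where

  period-* : ∀ {a} → Period f x a → ∀ c → Period f x (c * a)
  period-*     pa zero    = refl
  period-* {a} pa (suc c) = begin
    iter f (a + c * a) x        ≡⟨ iter-+ f a (c * a) x ⟩
    iter f a (iter f (c * a) x) ≡⟨ cong (iter f a) (period-* pa c) ⟩
    iter f a x                  ≡⟨ pa ⟩
    x                           ∎

  period-∣ : ∀ {d a} → Period f x d → d ∣ a → Period f x a
  period-∣ pd (divides-refl c) = period-* pd c

  period-cancelʳ : ∀ {d b} → Period f x (d + b) → Period f x b → Period f x d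
  period-cancelʳ {d} {b} pdb pb = begin
    iter f d x              ≡⟨ cong (iter f d) pb ⟨
    iter f d (iter f b x)   ≡⟨ iter-+ f d b x ⟨
    iter f (d + b) x        ≡⟨ pdb ⟩
    x                       ∎

  period-gcd : ∀ {a b} → Period f x a → Period f x b → Period f x (gcd a b)
  period-gcd {a} {b} pa pb with Bézout.identity (gcd-GCD a b)
  ... | Bézout.+- u v eq = period-cancelʳ {d = gcd a b} {v * b}
    (subst (Period f x) (sym eq) (period-* pa u)) (period-* pb v)
  ... | Bézout.-+ u v eq = period-cancelʳ {d = gcd a b} {u * a}
    (subst (Period f x) (sym eq) (period-* pb v)) (period-* pa u)

∣p^[1+s]∧<⇒∣p^s : ∀ {p} → Prime p → ∀ s {d} → d ∣ p ^ suc s → d < p ^ suc s → d ∣ p ^ s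
∣p^[1+s]∧<⇒∣p^s {p} pr s {d} d∣p^[1+s]@(divides q eq) d<p^[1+s]
  with euclidsLemma q d pr (subst (p ∣_) eq (m∣m*n (p ^ s)))
... | inj₁ p∣q = *-cancelˡ-∣ p (subst (p * d ∣_) (sym eq) (*-monoˡ-∣ d p∣q))
  where instance _ = prime⇒nonZero pr
... | inj₂ (divides-refl e) = e*p∣p^s s e∣p^s e<p^s
  where
  instance _ = prime⇒nonZero pr
  e∣p^s : e ∣ p ^ s
  e∣p^s = *-cancelʳ-∣ p (subst (e * p ∣_) (*-comm p (p ^ s)) d∣p^[1+s])
  e<p^s : e < p ^ s
  e<p^s = *-cancelʳ-< p e (p ^ s) (subst (e * p <_) (*-comm p (p ^ s)) d<p^[1+s])
  e*p∣p^s : ∀ s → e ∣ p ^ s → e < p ^ s → e * p ∣ p ^ s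
  e*p∣p^s zero     e∣1   e<1   = contradiction (∣1⇒≡1 e∣1) (<⇒≢ e<1)
  e*p∣p^s (suc s′) e∣p^s e<p^s =
    subst (e * p ∣_) (*-comm (p ^ s′) p) (*-monoˡ-∣ p (∣p^[1+s]∧<⇒∣p^s pr s′ e∣p^s e<p^s))

cycleLength-p^[1+s] : ∀ {f x p} → Prime p → ∀ s →
                      Period f x (p ^ suc s) → ¬ Period f x (p ^ s) → CycleLength f x (p ^ suc s)
cycleLength-p^[1+s] {f} {x} {p} pr s per ¬per = m^n>0 p (suc s) , per , no-shorter-period
  where
  instance _ = prime⇒nonZero pr
  no-shorter-period : ∀ b → 1 ≤ b → b < p ^ suc s → ¬ Period f x b
  no-shorter-period b@(suc _) _ b<p^[1+s] per-b =
    ¬per (period-∣ (period-gcd {a = b} {b = p ^ suc s} per-b per) g∣p^s)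
    where
    g∣p^s : gcd b (p ^ suc s) ∣ p ^ s
    g∣p^s = ∣p^[1+s]∧<⇒∣p^s pr s (gcd[m,n]∣n b _)
              (≤-<-trans (∣⇒≤ (gcd[m,n]∣m b (p ^ suc s))) b<p^[1+s])

data ParityView : ℕ → Set where
  even : ∀ i → ParityView (i + i)
  odd  : ∀ i → ParityView (suc (i + i))

parityView : ∀ j → ParityView j
parityView zero          = even 0
parityView (suc zero)    = odd 0
parityView (suc (suc j)) with parityView j
... | even i = subst ParityView (+-suc (suc i) i) (even (suc i))
... | odd i  = subst ParityView (cong suc (+-suc (suc i) i)) (odd (suc i))

isEven-even : ∀ i → isEven (i + i) ≡ true
isEven-even zero    = refl
isEven-even (suc i) rewrite +-suc i i = isEven-even i

isEven-odd : ∀ i → isEven (suc (i + i)) ≡ false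
isEven-odd zero    = refl
isEven-odd (suc i) rewrite +-suc i i = isEven-odd i

ψ-even : ∀ n i → ψ n (i + i) ≡ i
ψ-even n i rewrite isEven-even i = sym (n≡⌊n+n/2⌋ i)

ψ-odd : ∀ n i → ψ n (suc (i + i)) ≡ n + suc i
ψ-odd n i rewrite isEven-odd i = cong (λ h → n + suc h) (sym (n≡⌊n+n/2⌋ i))

ψ-inverts-doubling : ∀ n j → ∃ λ c → 2 * ψ n j ≡ j + c * (1 + 2 * n)
ψ-inverts-doubling n j with parityView j
... | even i rewrite ψ-even n i = 0 , solve 1 (λ i → con 2 :* i := (i :+ i) :+ con 0) refl i
... | odd i  rewrite ψ-odd n i  = 1 , solve 2 (λ n i → con 2 :* (n :+ (con 1 :+ i))
                                      := (con 1 :+ (i :+ i)) :+ con 1 :* (con 1 :+ con 2 :* n)) refl n i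

InRange : ℕ → ℕ → Set
InRange n j = 1 ≤ j × j ≤ 2 * n

ψ-inRange : ∀ n {j} → InRange n j → InRange n (ψ n j)
ψ-inRange n {j} (1≤j , j≤2n) with parityView j
... | even i rewrite ψ-even n i = 1≤i i 1≤j , ≤-trans (m≤m+n i i) j≤2n
  where
  1≤i : ∀ i → 1 ≤ i + i → 1 ≤ i
  1≤i (suc _) _ = s≤s z≤n
... | odd i  rewrite ψ-odd n i  = ≤-trans (s≤s z≤n) (m≤n+m (suc i) n) , n+[1+i]≤2n
  where
  i<n : i < n
  i<n = *-cancelˡ-< 2 i n (subst (_< 2 * n) (cong (i +_) (sym (+-identityʳ i))) j≤2n)
  n+[1+i]≤2n : n + suc i ≤ 2 * n
  n+[1+i]≤2n = +-monoʳ-≤ n (subst (suc i ≤_) (sym (+-identityʳ n)) i<n)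

iter-congruence : ∀ (f : ℕ → ℕ) {b m} → (∀ y → ∃ λ c → b * f y ≡ y + c * m) →
                  ∀ a x → ∃ λ c → b ^ a * iter f a x ≡ x + c * m
iter-congruence f         step zero    x = 0 , refl
iter-congruence f {b} {m} step (suc a) x
  with c , b^a*y≡x+c*m ← iter-congruence f step a x
     | c′ , b*fy≡y+c′*m ← step (iter f a x)
  = c + b ^ a * c′ , (begin
    b * b ^ a * f y
      ≡⟨ solve 3 (λ b p z → b :* p :* z := p :* (b :* z)) refl b (b ^ a) (f y) ⟩
    b ^ a * (b * f y)
      ≡⟨ cong (b ^ a *_) b*fy≡y+c′*m ⟩
    b ^ a * (y + c′ * m)
      ≡⟨ solve 4 (λ p y c′ m → p :* (y :+ c′ :* m) := p :* y :+ p :* c′ :* m) refl (b ^ a) y c′ m ⟩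
    b ^ a * y + b ^ a * c′ * m
      ≡⟨ cong (_+ b ^ a * c′ * m) b^a*y≡x+c*m ⟩
    x + c * m + b ^ a * c′ * m
      ≡⟨ solve 4 (λ x c d m → x :+ c :* m :+ d :* m := x :+ (c :+ d) :* m) refl x c (b ^ a * c′) m ⟩
    x + (c + b ^ a * c′) * m
      ∎)
  where
  y : ℕ
  y = iter f a x

m∣n∧0<n<m+m⇒n≡m : ∀ {m n} → m ∣ n → 0 < n → n < m + m → n ≡ m
m∣n∧0<n<m+m⇒n≡m     (divides-refl zero)          ()
m∣n∧0<n<m+m⇒n≡m {m} (divides-refl (suc zero))    _ _    = +-identityʳ m
m∣n∧0<n<m+m⇒n≡m {m} (divides-refl (suc (suc q))) _ n<2m =
  contradiction n<2m (≤⇒≯ (+-monoʳ-≤ m (m≤m+n m (q * m))))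

module _ {t n : ℕ} (2^t≡2n : 2 ^ t ≡ 2 * n) where

  iter-ψ-inRange : ∀ {j} → InRange n j → InRange n (iter (ψ n) t j)
  iter-ψ-inRange = iter-preserves (InRange n) (ψ-inRange n) t

  -- 1 + 2n divides j + ψ^t j because 2 ^ t ≡ -1 (mod 1 + 2n), and 0 < j + ψ^t j < 2 (1 + 2n).
  ψ^t-complement : ∀ {j} → InRange n j → j + iter (ψ n) t j ≡ 1 + 2 * n
  ψ^t-complement {j} j∈@(1≤j , j≤2n)
    with c , 2^t*y≡j+c*m ← iter-congruence (ψ n) (ψ-inverts-doubling n) t j
    = m∣n∧0<n<m+m⇒n≡m m∣j+y (≤-trans 1≤j (m≤m+n j y)) j+y<m+m
    where
    m y : ℕ
    m = 1 + 2 * n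
    y = iter (ψ n) t j
    m*y≡c*m+[j+y] : m * y ≡ c * m + (j + y)
    m*y≡c*m+[j+y] = begin
      y + 2 * n * y     ≡⟨ cong (λ z → y + z * y) 2^t≡2n ⟨
      y + 2 ^ t * y     ≡⟨ cong (y +_) 2^t*y≡j+c*m ⟩
      y + (j + c * m)   ≡⟨ solve 4 (λ y j c m → y :+ (j :+ c :* m) := c :* m :+ (j :+ y)) refl y j c m ⟩
      c * m + (j + y)   ∎
    m∣j+y : m ∣ j + y
    m∣j+y = ∣m+n∣m⇒∣n (subst (m ∣_) m*y≡c*m+[j+y] (m∣m*n y)) (n∣m*n c)
    j+y<m+m : j + y < m + m
    j+y<m+m = s≤s (+-mono-≤ j≤2n (≤-trans (proj₂ (iter-ψ-inRange j∈)) (n≤1+n (2 * n))))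

  ψ^[2t]-fixes : ∀ {j} → InRange n j → Period (ψ n) j (2 * t)
  ψ^[2t]-fixes {j} j∈ = begin
    iter (ψ n) (t + (t + 0)) j   ≡⟨ cong (λ a → iter (ψ n) (t + a) j) (+-identityʳ t) ⟩
    iter (ψ n) (t + t) j         ≡⟨ iter-+ (ψ n) t t j ⟩
    iter (ψ n) t y               ≡⟨ +-cancelˡ-≡ y _ _ y+ψ^t[y]≡y+j ⟩
    j                            ∎
    where
    y : ℕ
    y = iter (ψ n) t j
    y+ψ^t[y]≡y+j : y + iter (ψ n) t y ≡ y + j
    y+ψ^t[y]≡y+j = begin
      y + iter (ψ n) t y   ≡⟨ ψ^t-complement (iter-ψ-inRange j∈) ⟩
      1 + 2 * n            ≡⟨ ψ^t-complement j∈ ⟨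
      j + y                ≡⟨ +-comm j y ⟩
      y + j                ∎

  ψ^t-moves : ∀ {j} → InRange n j → ¬ Period (ψ n) j t
  ψ^t-moves {j} j∈ ψ^t[j]≡j = even≢odd j n (begin
    j + (j + 0)          ≡⟨ cong (j +_) (+-identityʳ j) ⟩
    j + j                ≡⟨ cong (j +_) ψ^t[j]≡j ⟨
    j + iter (ψ n) t j   ≡⟨ ψ^t-complement j∈ ⟩
    1 + 2 * n            ∎)

ψ-cycleLength : ∀ s {n j} → 2 ^ (2 ^ s) ≡ 2 * n → InRange n j → CycleLength (ψ n) j (2 ^ suc s)
ψ-cycleLength s 2^[2^s]≡2n j∈ = cycleLength-p^[1+s] prime[2] s
  (ψ^[2t]-fixes {t = 2 ^ s} 2^[2^s]≡2n j∈) (ψ^t-moves {t = 2 ^ s} 2^[2^s]≡2n j∈)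

n<2^n : ∀ n → n < 2 ^ n
n<2^n zero    = s≤s z≤n
n<2^n (suc n) = ≤-trans (+-mono-≤ (m^n>0 2 n) (n<2^n n))
                        (≤-reflexive (cong (2 ^ n +_) (sym (+-identityʳ (2 ^ n)))))

theorem4 : ∀ (k : ℕ) → 1 ≤ k → ∀ (N : ℕ) →
    Σ ℕ (λ n → (N ≤ n) × (1 ≤ n) × AllCyclesLongerThan k n)
theorem4 k _ N = n , N≤n , m^n>0 2 (pred (2 ^ s)) ,
                 λ j 1≤j j≤2n → 2 ^ suc s , ψ-cycleLength s 2^[2^s]≡2n (1≤j , j≤2n) , k<2^[1+s]
  where
  -- 2n + 1 is the Fermat number 2 ^ 2 ^ s + 1.
  s n : ℕ
  s = k + N
  n = 2 ^ pred (2 ^ s)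
  2^[2^s]≡2n : 2 ^ (2 ^ s) ≡ 2 * n
  2^[2^s]≡2n = cong (2 ^_) (sym (suc-pred (2 ^ s) {{m^n≢0 2 s}}))
  N≤n : N ≤ n
  N≤n = ≤-trans (m≤n+m N k) (≤-trans (<⇒≤pred (n<2^n s)) (<⇒≤ (n<2^n _)))
  k<2^[1+s] : k < 2 ^ suc s
  k<2^[1+s] = <-trans (s≤s (m≤m+n k N)) (n<2^n (suc s))
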